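{- Let $n\ge3$ and $1<k<n$. Then $$b(n-1,k-1)=\#\{\sigma\in BP_2(n,k):\ \sigma(k)=n,\ \sigma(n)<k\},$$ where $b(n-1,k-1)=|BP_2(n-1,k-1)|$.
   Context: $\mathfrak{S}_n$ is the symmetric group on $[n]$. A weak exceedance of $\sigma$ is a position $i$ with $\sigma(i)\ge i$. For $\sigma\in\mathfrak{S}_n$ and $i\in[n]$, $\mathrm{inom}(i)=\sigma^{ -t}(i)$ where $t\ge1$ is smallest with $\sigma^{ -t}(i)\le i$; the inom code of $\sigma$ is $f_1\cdots f_n$ with $f_i=\mathrm{inom}(i)$ (equivalently the unique subexceedant function with $\sigma=(n\ f_n)\cdots(1\ f_1)$, leftmost transposition acting first). $BP_2(n)$ (Bell permutations of the second kind) is the set of $\sigma\in\mathfrak{S}_n$ whose inom code has $\{f_1,\dots,f_i\}$ an integer interval for every $i\in[n]$; $BP_2(n,k)$ is the subset of those with exactly $k$ weak exceedances. -}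

module Defs where

open import Data.Nat as ℕ using (ℕ; zero; suc; _∸_)
open import Data.Fin as F using (Fin; toℕ)
open import Data.Fin.Properties using (all?; any?) renaming (_≟_ to _≟ᶠ_)
open import Data.Vec using (Vec; []; _∷_; lookup)
open import Data.List as L using (List; length; filter; concatMap; map; allFin)
open import Data.Product using (Σ; _×_; _,_; ∃)
open import Data.Bool using (if_then_else_)
open import Relation.Nullary using (Dec; yes; no; does)
open import Relation.Nullary.Decidable using (_×-dec_; _→-dec_)
open import Relation.Binary.PropositionalEquality using (_≡_)

-- Conventions: [n] = {1,…,n} is represented by Fin n (0-based: element i of
-- Fin n stands for i+1).  A map [n] → [n] is its one-line notation, a vector
-- σ : Vec (Fin n) n with σ(i) = lookup σ i.

allVecs : (m n : ℕ) → List (Vec (Fin n) m)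
allVecs zero    n = L.[ [] ]
allVecs (suc m) n = concatMap (λ x → map (x ∷_) (allVecs m n)) (allFin n)

-- σ is a permutation of [n] (injective, hence bijective on the finite set)
IsPerm : {n : ℕ} → Vec (Fin n) n → Set
IsPerm {n} σ = (i j : Fin n) → lookup σ i ≡ lookup σ j → i ≡ j

isPerm? : {n : ℕ} (σ : Vec (Fin n) n) → Dec (IsPerm σ)
isPerm? σ = all? λ i → all? λ j → (lookup σ i ≟ᶠ lookup σ j) →-dec (i ≟ᶠ j)

Sym : (n : ℕ) → List (Vec (Fin n) n)
Sym n = filter isPerm? (allVecs n n)

findPre : {n : ℕ} → Vec (Fin n) n → Fin n → List (Fin n) → Fin n
findPre σ i L.[] = i
findPre σ i (j L.∷ js) = if does (lookup σ j ≟ᶠ i) then j else findPre σ i js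

inv : {n : ℕ} → Vec (Fin n) n → Fin n → Fin n
inv {n} σ i = findPre σ i (allFin n)

-- With x = i and fuel n this returns σ^{-t}(i) for the least t ≥ 1 with
-- σ^{-t}(i) ≤ i (t is at most the cycle length of i, which is ≤ n).
inomAux : {n : ℕ} → Vec (Fin n) n → ℕ → Fin n → Fin n → Fin n
inomAux σ zero    i x = i
inomAux σ (suc fuel) i x with inv σ x F.≤? i
... | yes _ = inv σ x
... | no  _ = inomAux σ fuel i (inv σ x)

inom : {n : ℕ} → Vec (Fin n) n → Fin n → Fin n
inom {n} σ i = inomAux σ n i i

inomCode : {n : ℕ} → Vec (Fin n) n → Fin n → Fin n
inomCode = inom

InPrefix : {n : ℕ} → (Fin n → Fin n) → Fin n → Fin n → Set
InPrefix f i a = ∃ λ j → (j F.≤ i) × (f j ≡ a)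

inPrefix? : {n : ℕ} (f : Fin n → Fin n) (i a : Fin n) → Dec (InPrefix f i a)
inPrefix? f i a = any? λ j → (j F.≤? i) ×-dec (f j ≟ᶠ a)

PrefixInterval : {n : ℕ} → (Fin n → Fin n) → Fin n → Set
PrefixInterval {n} f i = (a b c : Fin n) → a F.≤ b → b F.≤ c →
  InPrefix f i a → InPrefix f i c → InPrefix f i b

prefixInterval? : {n : ℕ} (f : Fin n → Fin n) (i : Fin n) → Dec (PrefixInterval f i)
prefixInterval? f i = all? λ a → all? λ b → all? λ c →
  (a F.≤? b) →-dec (b F.≤? c) →-dec (inPrefix? f i a) →-dec (inPrefix? f i c)
  →-dec (inPrefix? f i b)

-- σ ∈ BP₂(n) (σ assumed a permutation): every prefix set of the inom code is an interval
IsBP2 : {n : ℕ} → Vec (Fin n) n → Set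
IsBP2 {n} σ = (i : Fin n) → PrefixInterval (inomCode σ) i

isBP2? : {n : ℕ} (σ : Vec (Fin n) n) → Dec (IsBP2 σ)
isBP2? σ = all? λ i → prefixInterval? (inomCode σ) i

wex : {n : ℕ} → Vec (Fin n) n → ℕ
wex {n} σ = length (filter (λ i → i F.≤? lookup σ i) (allFin n))

-- BP₂(n, k) as a list (each permutation occurs exactly once)
BP2 : (n k : ℕ) → List (Vec (Fin n) n)
BP2 n k = filter (λ σ → wex σ ℕ.≟ k) (filter isBP2? (Sym n))

b : ℕ → ℕ → ℕ
b n k = length (BP2 n k)

-- σ(k) = n, in 1-based terms: the position with 0-based index k-1 maps to
-- the element with 0-based index n-1
MapsKtoN : {n : ℕ} → Vec (Fin n) n → ℕ → Set
MapsKtoN {n} σ k = ∃ λ p → (toℕ p ≡ k ∸ 1) × (toℕ (lookup σ p) ≡ n ∸ 1)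

mapsKtoN? : {n : ℕ} (σ : Vec (Fin n) n) (k : ℕ) → Dec (MapsKtoN σ k)
mapsKtoN? {n} σ k = any? λ p → (toℕ p ℕ.≟ k ∸ 1) ×-dec (toℕ (lookup σ p) ℕ.≟ n ∸ 1)

-- σ(n) < k, in 1-based terms: (toℕ σ(last) + 1) < k
LastBelow : {n : ℕ} → Vec (Fin n) n → ℕ → Set
LastBelow {n} σ k = (p : Fin n) → toℕ p ≡ n ∸ 1 → suc (toℕ (lookup σ p)) ℕ.< k

lastBelow? : {n : ℕ} (σ : Vec (Fin n) n) (k : ℕ) → Dec (LastBelow σ k)
lastBelow? {n} σ k = all? λ p → (toℕ p ℕ.≟ n ∸ 1) →-dec (suc (toℕ (lookup σ p)) ℕ.<? k)

countKN : ℕ → ℕ → ℕ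
countKN n k = length (filter (λ σ → lastBelow? σ k) (filter (λ σ → mapsKtoN? σ k) (BP2 n k)))

-- Inserting n into τ ∈ BP₂(n-1, k-1) by σ(k) = n and σ(n) = τ(k), all other values kept, is the
-- bijection.  Since inom(i) is the unique j ≤ i whose σ-orbit returns to i through values above i only,
-- the inom code of σ is that of τ followed by fₙ = k.  The values of an inom code are exactly the weak
-- exceedances, and the interval condition for the whole code makes them an initial segment, so the
-- k-1 weak exceedances of τ are 1, …, k-1.  Hence k is not one, i.e. σ(n) = τ(k) < k, σ gains exactly
-- the weak exceedance k, and {f₁, …, fₙ} = {1, …, k} is an interval.  Conversely σ(n) < k says that k is
-- not a weak exceedance of τ, which is all the inverse map needs.

module Submission where

open import Defs
open import Data.Nat as ℕ using (ℕ; zero; suc; z≤n; s≤s; _≤_; _<_; _∸_)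
import Data.Nat.Properties as ℕ
open import Data.Fin as F using (Fin; toℕ; zero; suc; inject₁; fromℕ; fromℕ<)
import Data.Fin.Properties as F
open import Data.Fin.Permutation.Components using (transpose)
open import Data.Fin.Relation.Unary.Top using (View; view; ‵fromℕ; ‵inject₁; view-inject₁; view-fromℕ)
open import Data.Vec using (Vec; []; _∷_; lookup; tabulate)
open import Data.Vec.Properties using (∷-injective; lookup∘tabulate)
open import Data.Vec.Relation.Binary.Pointwise.Extensional using (ext; Pointwise-≡⇒≡)
open import Data.List as L using (List; length; filter; map; allFin; cartesianProductWith)
open import Data.List.Properties using (length-map)
open import Data.List.Membership.Propositional using (_∈_)
open import Data.List.Membership.Propositional.Properties
  using (∈-map⁺; ∈-map⁻; ∈-cartesianProductWith⁺; ∈-allFin; ∈-filter⁺; ∈-filter⁻)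
open import Data.List.Membership.Propositional.Properties.WithK using (unique∧set⇒bag)
open import Data.List.Relation.Unary.Any using (here; there)
import Data.List.Relation.Unary.All as All
import Data.List.Relation.Unary.AllPairs as AllPairs
open import Data.List.Relation.Unary.Unique.Propositional using (Unique)
import Data.List.Relation.Unary.Unique.Propositional.Properties as Unique
open import Data.List.Relation.Binary.BagAndSetEquality using (∼bag⇒↭)
open import Data.List.Relation.Binary.Permutation.Propositional.Properties using (↭-length)
open import Data.Product using (_×_; _,_; ∃; proj₁; proj₂)
open import Data.Sum using (_⊎_; inj₁; inj₂)
open import Function.Base using (_∘_; id)
open import Function.Bundles using (_⇔_; mk⇔; Equivalence)
open import Function.Definitions using (Injective)
open import Level using (0ℓ)
open import Relation.Binary.Definitions using (tri<; tri≈; tri>)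
open import Relation.Binary.PropositionalEquality
open import Relation.Nullary using (Dec; yes; no; ¬_; contradiction)
open import Relation.Nullary.Decidable using (dec-true; dec-false)
open import Relation.Unary using (Pred; Decidable; _⊆_)

-- Enumerations

length-≡-by-bijection : {A B : Set} {xs : List A} {ys : List B} → Unique xs → Unique ys →
  (f : A → B) → Injective _≡_ _≡_ f →
  (∀ {a} → a ∈ xs → f a ∈ ys) → (∀ {y} → y ∈ ys → ∃ λ a → a ∈ xs × f a ≡ y) →
  length xs ≡ length ys
length-≡-by-bijection {xs = xs} xs! ys! f f-inj into onto =
  trans (sym (length-map f xs))
        (↭-length (∼bag⇒↭ (unique∧set⇒bag (Unique.map⁺ f-inj xs!) ys! (mk⇔ from-image to-image))))
  where
  from-image : ∀ {y} → y ∈ map f xs → y ∈ _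
  from-image y∈ with ∈-map⁻ f y∈
  ... | a , a∈ , refl = into a∈
  to-image : ∀ {y} → y ∈ _ → y ∈ map f xs
  to-image y∈ with onto y∈
  ... | a , a∈ , refl = ∈-map⁺ f a∈

allVecs-suc : (m n : ℕ) → allVecs (suc m) n ≡ cartesianProductWith _∷_ (allFin n) (allVecs m n)
allVecs-suc m n = go (allFin n)
  where
  go : (xs : List (Fin n)) →
    L.concat (map (λ x → map (x ∷_) (allVecs m n)) xs) ≡ cartesianProductWith _∷_ xs (allVecs m n)
  go L.[]       = refl
  go (x L.∷ xs) = cong (map (x ∷_) (allVecs m n) L.++_) (go xs)

allVecs-unique : (m n : ℕ) → Unique (allVecs m n)
allVecs-unique zero    n = All.[] AllPairs.∷ AllPairs.[]
allVecs-unique (suc m) n rewrite allVecs-suc m n =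
  Unique.cartesianProductWith⁺ _∷_ ∷-injective (Unique.allFin⁺ n) (allVecs-unique m n)

∈-allVecs : {m n : ℕ} (v : Vec (Fin n) m) → v ∈ allVecs m n
∈-allVecs {zero}      []      = here refl
∈-allVecs {suc m} {n} (x ∷ v) rewrite allVecs-suc m n =
  ∈-cartesianProductWith⁺ _∷_ (∈-allFin x) (∈-allVecs v)

∈-BP2⁻ : ∀ {n k σ} → σ ∈ BP2 n k → IsPerm σ × IsBP2 σ × wex σ ≡ k
∈-BP2⁻ {n} {k} σ∈ with ∈-filter⁻ (λ σ → wex σ ℕ.≟ k) σ∈
... | σ∈′ , wex≡k with ∈-filter⁻ isBP2? σ∈′
... | σ∈″ , bp with ∈-filter⁻ isPerm? {xs = allVecs n n} σ∈″
... | _ , perm = perm , bp , wex≡k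

∈-BP2⁺ : ∀ {n k σ} → IsPerm σ → IsBP2 σ → wex σ ≡ k → σ ∈ BP2 n k
∈-BP2⁺ {k = k} {σ} perm bp wex≡k =
  ∈-filter⁺ (λ σ → wex σ ℕ.≟ k) (∈-filter⁺ isBP2? (∈-filter⁺ isPerm? (∈-allVecs σ) perm) bp) wex≡k

BP2-unique : ∀ n k → Unique (BP2 n k)
BP2-unique n k = Unique.filter⁺ (λ σ → wex σ ℕ.≟ k)
  (Unique.filter⁺ isBP2? (Unique.filter⁺ isPerm? (allVecs-unique n n)))

-- Counting in Fin n

count : ∀ {n} {P : Pred (Fin n) 0ℓ} → Decidable P → ℕ
count {zero}  P? = 0
count {suc n} P? with P? zero
... | yes _ = suc (count (P? ∘ suc))
... | no  _ = count (P? ∘ suc)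

length-filter-tabulate : ∀ {A : Set} {n} {P : Pred A 0ℓ} (P? : Decidable P) (f : Fin n → A) →
  length (filter P? (L.tabulate f)) ≡ count (P? ∘ f)
length-filter-tabulate {n = zero}  P? f = refl
length-filter-tabulate {n = suc n} P? f with P? (f zero)
... | yes _ = cong suc (length-filter-tabulate P? (f ∘ suc))
... | no  _ = length-filter-tabulate P? (f ∘ suc)

count-cong : ∀ {n} {P Q : Pred (Fin n) 0ℓ} (P? : Decidable P) (Q? : Decidable Q) →
  P ⊆ Q → Q ⊆ P → count P? ≡ count Q?
count-cong {zero}  P? Q? P⊆Q Q⊆P = refl
count-cong {suc n} P? Q? P⊆Q Q⊆P with P? zero | Q? zero
... | yes _  | yes _  = cong suc (count-cong (P? ∘ suc) (Q? ∘ suc) P⊆Q Q⊆P)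
... | no  _  | no  _  = count-cong (P? ∘ suc) (Q? ∘ suc) P⊆Q Q⊆P
... | yes p  | no ¬q  = contradiction (P⊆Q p) ¬q
... | no ¬p  | yes q  = contradiction (Q⊆P q) ¬p

count-none : ∀ {n} {P : Pred (Fin n) 0ℓ} (P? : Decidable P) → (∀ x → ¬ P x) → count P? ≡ 0
count-none {zero}  P? none = refl
count-none {suc n} P? none with P? zero
... | yes p = contradiction p (none zero)
... | no  _ = count-none (P? ∘ suc) (none ∘ suc)

count-¬fromℕ : ∀ {n} {P : Pred (Fin (suc n)) 0ℓ} (P? : Decidable P) → ¬ P (fromℕ n) →
  count P? ≡ count (P? ∘ inject₁)
count-¬fromℕ {zero}  P? ¬top with P? zero
... | yes top = contradiction top ¬top
... | no  _   = refl
count-¬fromℕ {suc n} P? ¬top with P? zero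
... | yes _ = cong suc (count-¬fromℕ (P? ∘ suc) ¬top)
... | no  _ = count-¬fromℕ (P? ∘ suc) ¬top

count-one-extra : ∀ {n} {P Q : Pred (Fin n) 0ℓ} (P? : Decidable P) (Q? : Decidable Q) (K : Fin n) →
  (∀ x → x ≢ K → P x → Q x) → (∀ x → x ≢ K → Q x → P x) → P K → ¬ Q K →
  count P? ≡ suc (count Q?)
count-one-extra {suc n} P? Q? zero P⇒Q Q⇒P pK ¬qK with P? zero | Q? zero
... | no ¬p | _     = contradiction pK ¬p
... | yes _ | yes q = contradiction q ¬qK
... | yes _ | no  _ = cong suc (count-cong (P? ∘ suc) (Q? ∘ suc)
                        (P⇒Q _ (λ ())) (Q⇒P _ (λ ())))
count-one-extra {suc n} P? Q? (suc K) P⇒Q Q⇒P pK ¬qK with P? zero | Q? zero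
... | yes _ | yes _ = cong suc (count-one-extra (P? ∘ suc) (Q? ∘ suc) K
                        (λ x x≢K → P⇒Q (suc x) (x≢K ∘ F.suc-injective))
                        (λ x x≢K → Q⇒P (suc x) (x≢K ∘ F.suc-injective)) pK ¬qK)
... | no  _ | no  _ = count-one-extra (P? ∘ suc) (Q? ∘ suc) K
                        (λ x x≢K → P⇒Q (suc x) (x≢K ∘ F.suc-injective))
                        (λ x x≢K → Q⇒P (suc x) (x≢K ∘ F.suc-injective)) pK ¬qK
... | yes p | no ¬q = contradiction (P⇒Q zero (λ ()) p) ¬q
... | no ¬p | yes q = contradiction (Q⇒P zero (λ ()) q) ¬p

DownClosed : ∀ {n} → Pred (Fin n) 0ℓ → Set
DownClosed P = ∀ {x y} → x F.≤ y → P y → P x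

downClosed⇔<count : ∀ {n} {P : Pred (Fin n) 0ℓ} (P? : Decidable P) → DownClosed P →
  ∀ x → P x ⇔ toℕ x < count P?
downClosed⇔<count {suc n} P? closed x with P? zero
downClosed⇔<count {suc n} P? closed zero    | yes p₀ = mk⇔ (λ _ → s≤s z≤n) (λ _ → p₀)
downClosed⇔<count {suc n} P? closed (suc x) | yes _  =
  mk⇔ (s≤s ∘ to) (from ∘ ℕ.s≤s⁻¹)
  where open Equivalence (downClosed⇔<count (P? ∘ suc) (closed ∘ s≤s) x)
... | no ¬p₀ = mk⇔ (λ px → contradiction (closed z≤n px) ¬p₀)
                   (λ x<c → contradiction (subst (toℕ x <_) count≡0 x<c) λ ())
  where
  count≡0 : count (P? ∘ suc) ≡ 0
  count≡0 = count-none (P? ∘ suc) (λ y py → ¬p₀ (closed z≤n py))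

-- The inom code

injective⇒surjective : ∀ {N} (f : Fin N → Fin N) → Injective _≡_ _≡_ f → ∀ y → ∃ λ x → f x ≡ y
injective⇒surjective {suc N} f f-inj y with F.any? (λ x → f x F.≟ y)
... | yes hit = hit
... | no miss = contradiction (F.injective⇒≤ punched-injective) ℕ.1+n≰n
  where
  f≢y : ∀ x → y ≢ f x
  f≢y x y≡fx = miss (x , sym y≡fx)
  punched : Fin (suc N) → Fin N
  punched x = F.punchOut (f≢y x)
  punched-injective : Injective _≡_ _≡_ punched
  punched-injective eq = f-inj (F.punchOut-injective (f≢y _) (f≢y _) eq)

module Inom {N : ℕ} (σ : Vec (Fin N) N) (σ-perm : IsPerm σ) where

  private
    s : Fin N → Fin N
    s = lookup σ

  findPre-correct : ∀ x (xs : List (Fin N)) → (∃ λ y → y ∈ xs × s y ≡ x) → s (findPre σ x xs) ≡ x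
  findPre-correct x (j L.∷ js) (y , y∈ , sy≡x) with s j F.≟ x | y∈
  ... | yes sj≡x | _         = sj≡x
  ... | no  sj≢x | here refl = contradiction sy≡x sj≢x
  ... | no  _    | there y∈′ = findPre-correct x js (y , y∈′ , sy≡x)

  lookup-inv : ∀ x → s (inv σ x) ≡ x
  lookup-inv x with injective⇒surjective s (σ-perm _ _) x
  ... | y , sy≡x = findPre-correct x (allFin N) (y , ∈-allFin y , sy≡x)

  inv-unique : ∀ {x y} → s y ≡ x → inv σ x ≡ y
  inv-unique {x} sy≡x = σ-perm _ _ (trans (lookup-inv x) (sym sy≡x))

  inv-injective : Injective _≡_ _≡_ (inv σ)
  inv-injective {x} {y} eq = trans (sym (lookup-inv x)) (trans (cong s eq) (lookup-inv y))

  inv^ : ℕ → Fin N → Fin N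
  inv^ zero    x = x
  inv^ (suc t) x = inv σ (inv^ t x)

  Above : Fin N → ℕ → Set
  Above i t = ∀ u → 0 < u → u < t → i F.< inv^ u i

  Above-1 : ∀ i → Above i 1
  Above-1 i u 0<u (s≤s u≤0) = contradiction (ℕ.<-≤-trans 0<u u≤0) (ℕ.<-irrefl refl)

  Above-suc : ∀ {i t} → Above i t → i F.< inv^ t i → Above i (suc t)
  Above-suc above i<σ⁻ᵗi u 0<u u<1+t with ℕ.m≤n⇒m<n∨m≡n (ℕ.s≤s⁻¹ u<1+t)
  ... | inj₁ u<t  = above u 0<u u<t
  ... | inj₂ refl = i<σ⁻ᵗi

  inv^-cancel : ∀ i a b → inv^ a i ≡ inv^ b i → a ≤ b → i ≡ inv^ (b ∸ a) i
  inv^-cancel i zero    b       eq _         = eq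
  inv^-cancel i (suc a) (suc b) eq (s≤s a≤b) = inv^-cancel i a b (inv-injective eq) a≤b

  -- Pigeonhole on σ⁻⁰(i), …, σ⁻ᴺ(i) yields a return to i after at most N steps.
  ¬Above-forever : ∀ i → ¬ Above i (suc N)
  ¬Above-forever i above with F.pigeonhole (ℕ.n<1+n N) (λ (a : Fin (suc N)) → inv^ (toℕ a) i)
  ... | a , b , a<b , eq = ℕ.<-irrefl refl (subst (λ z → toℕ i < toℕ z) (sym i≡σ⁻ᵈi) i<σ⁻ᵈi)
    where
    d : ℕ
    d = toℕ b ∸ toℕ a
    i≡σ⁻ᵈi : i ≡ inv^ d i
    i≡σ⁻ᵈi = inv^-cancel i (toℕ a) (toℕ b) eq (ℕ.<⇒≤ a<b)
    i<σ⁻ᵈi : i F.< inv^ d i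
    i<σ⁻ᵈi = above d (ℕ.m<n⇒0<n∸m a<b) (s≤s (ℕ.≤-trans (ℕ.m∸n≤m (toℕ b) (toℕ a)) (ℕ.s≤s⁻¹ (F.toℕ<n b))))

  FirstReturn : Fin N → ℕ → Set
  FirstReturn i t = 0 < t × Above i t × inv^ t i F.≤ i

  firstReturn-unique : ∀ {i t t′} → FirstReturn i t → FirstReturn i t′ → t ≡ t′
  firstReturn-unique {i} {t} {t′} (0<t , above , ≤i) (0<t′ , above′ , ≤i′) with ℕ.<-cmp t t′
  ... | tri< t<t′ _ _ = contradiction (ℕ.<-≤-trans (above′ t 0<t t<t′) ≤i) (ℕ.<-irrefl refl)
  ... | tri≈ _ t≡t′ _ = t≡t′
  ... | tri> _ _ t′<t = contradiction (ℕ.<-≤-trans (above t′ 0<t′ t′<t) ≤i′) (ℕ.<-irrefl refl)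

  inomAux-firstReturn : ∀ i fuel t → fuel ℕ.+ t ≡ N → Above i (suc t) →
    ∃ λ t′ → FirstReturn i t′ × inomAux σ fuel i (inv^ t i) ≡ inv^ t′ i
  inomAux-firstReturn i zero t refl above = contradiction above (¬Above-forever i)
  inomAux-firstReturn i (suc fuel) t eq above with inv^ (suc t) i F.≤? i
  ... | yes ≤i = suc t , (s≤s z≤n , above , ≤i) , refl
  ... | no  ≰i = inomAux-firstReturn i fuel (suc t) (trans (ℕ.+-suc fuel t) eq)
                   (Above-suc above (ℕ.≰⇒> ≰i))

  inom-firstReturn : ∀ i → ∃ λ t → FirstReturn i t × inom σ i ≡ inv^ t i
  inom-firstReturn i = inomAux-firstReturn i N 0 (ℕ.+-identityʳ N) (Above-1 i)

  data Reaches (i : Fin N) : Fin N → Set where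
    at  : Reaches i i
    via : ∀ {y} → i F.< y → Reaches i (s y) → Reaches i y

  Reaches⇒≤ : ∀ {i y} → Reaches i y → i F.≤ y
  Reaches⇒≤ at          = ℕ.≤-refl
  Reaches⇒≤ (via i<y _) = ℕ.<⇒≤ i<y

  iterate⇒Reaches : ∀ {i} t → Above i (suc t) → Reaches i (inv^ t i)
  iterate⇒Reaches zero    _     = at
  iterate⇒Reaches (suc t) above = via (above (suc t) (s≤s z≤n) ℕ.≤-refl)
    (subst (Reaches _) (sym (lookup-inv _))
      (iterate⇒Reaches t (λ u 0<u u<1+t → above u 0<u (ℕ.m≤n⇒m≤1+n u<1+t))))

  Reaches⇒iterate : ∀ {i y} → Reaches i y → ∃ λ t → Above i (suc t) × inv^ t i ≡ y
  Reaches⇒iterate {i} at = 0 , Above-1 i , refl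
  Reaches⇒iterate {i} {y} (via i<y r) with Reaches⇒iterate r
  ... | t , above , σ⁻ᵗi≡sy = suc t , Above-suc above (subst (i F.<_) (sym σ⁻¹⁺ᵗi≡y) i<y) , σ⁻¹⁺ᵗi≡y
    where
    σ⁻¹⁺ᵗi≡y : inv^ (suc t) i ≡ y
    σ⁻¹⁺ᵗi≡y = trans (cong (inv σ) σ⁻ᵗi≡sy) (inv-unique refl)

  inom-≤ : ∀ i → inom σ i F.≤ i
  inom-≤ i with inom-firstReturn i
  ... | t , (_ , _ , ≤i) , eq = subst (F._≤ i) (sym eq) ≤i

  inom-Reaches : ∀ i → Reaches i (s (inom σ i))
  inom-Reaches i with inom-firstReturn i
  ... | suc t , (_ , above , _) , eq =
    subst (Reaches i) (sym (trans (cong s eq) (lookup-inv _))) (iterate⇒Reaches t above)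

  inom-unique : ∀ {i x} → x F.≤ i → Reaches i (s x) → inom σ i ≡ x
  inom-unique {i} {x} x≤i r with inom-firstReturn i | Reaches⇒iterate r
  ... | t , ret , eq | t′ , above , σ⁻ᵗ′i≡sx =
    trans eq (trans (cong (λ u → inv^ u i) (firstReturn-unique ret ret′)) σ⁻¹⁺ᵗ′i≡x)
    where
    σ⁻¹⁺ᵗ′i≡x : inv^ (suc t′) i ≡ x
    σ⁻¹⁺ᵗ′i≡x = trans (cong (inv σ) σ⁻ᵗ′i≡sx) (inv-unique refl)
    ret′ : FirstReturn i (suc t′)
    ret′ = s≤s z≤n , above , subst (F._≤ i) (sym σ⁻¹⁺ᵗ′i≡x) x≤i

  inom-weakExceedance : ∀ i → inom σ i F.≤ s (inom σ i)
  inom-weakExceedance i = ℕ.≤-trans (inom-≤ i) (Reaches⇒≤ (inom-Reaches i))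

  inom-lookup : ∀ {x} → x F.≤ s x → inom σ (s x) ≡ x
  inom-lookup x≤sx = inom-unique x≤sx at

IsWeakExceedance : ∀ {n} → Vec (Fin n) n → Pred (Fin n) 0ℓ
IsWeakExceedance σ x = x F.≤ lookup σ x

module WeakExceedances {n : ℕ} (σ : Vec (Fin (suc n)) (suc n)) (σ-perm : IsPerm σ) where

  open Inom σ σ-perm

  inPrefix-fromℕ⇔weakExceedance : ∀ x → InPrefix (inom σ) (fromℕ n) x ⇔ IsWeakExceedance σ x
  inPrefix-fromℕ⇔weakExceedance x = mk⇔
    (λ { (j , _ , refl) → inom-weakExceedance j })
    (λ x≤σx → lookup σ x , F.≤fromℕ _ , inom-lookup x≤σx)

  weakExceedances-downClosed : IsBP2 σ → DownClosed (IsWeakExceedance σ)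
  -- 1 is always a weak exceedance, so the interval {f₁, …, fₙ} is an initial segment.
  weakExceedances-downClosed bp {x} {y} x≤y y≤σy = Equivalence.to (inPrefix-fromℕ⇔weakExceedance x)
    (bp (fromℕ n) zero x y z≤n x≤y (Equivalence.from (inPrefix-fromℕ⇔weakExceedance zero) z≤n)
      (Equivalence.from (inPrefix-fromℕ⇔weakExceedance y) y≤σy))

  weakExceedance⇔<wex : IsBP2 σ → ∀ x → IsWeakExceedance σ x ⇔ toℕ x < wex σ
  weakExceedance⇔<wex bp x rewrite length-filter-tabulate (λ i → i F.≤? lookup σ i) id =
    downClosed⇔<count (λ i → i F.≤? lookup σ i) (weakExceedances-downClosed bp) x

-- Inserting n

module _ {n} (i j : Fin n) where
  transpose-matchˡ : transpose i j i ≡ j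
  transpose-matchˡ rewrite dec-true (i F.≟ i) refl = refl

  transpose-matchʳ : transpose i j j ≡ i
  transpose-matchʳ with j F.≟ i
  ... | yes refl = refl
  ... | no j≢i rewrite dec-true (j F.≟ j) refl = refl

  transpose-other : ∀ {k} → k ≢ i → k ≢ j → transpose i j k ≡ k
  transpose-other {k} k≢i k≢j rewrite dec-false (k F.≟ i) k≢i | dec-false (k F.≟ j) k≢j = refl

  transpose-involutive : ∀ k → transpose i j (transpose i j k) ≡ k
  transpose-involutive k = by-cases (k F.≟ i) (k F.≟ j)
    where
    twice : Fin n → Fin n
    twice x = transpose i j (transpose i j x)
    by-cases : Dec (k ≡ i) → Dec (k ≡ j) → twice k ≡ k
    by-cases (yes k≡i) _ = trans (cong twice k≡i)
      (trans (cong (transpose i j) transpose-matchˡ) (trans transpose-matchʳ (sym k≡i)))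
    by-cases (no _) (yes k≡j) = trans (cong twice k≡j)
      (trans (cong (transpose i j) transpose-matchʳ) (trans transpose-matchˡ (sym k≡j)))
    by-cases (no k≢i) (no k≢j) =
      trans (cong (transpose i j) (transpose-other k≢i k≢j)) (transpose-other k≢i k≢j)

extend : ∀ {m} → (Fin m → Fin m) → Fin (suc m) → Fin (suc m)
extend t j with view j
... | ‵fromℕ     = fromℕ _
... | ‵inject₁ i = inject₁ (t i)

extend-inject₁ : ∀ {m} (t : Fin m → Fin m) i → extend t (inject₁ i) ≡ inject₁ (t i)
extend-inject₁ t i rewrite view-inject₁ i = refl

extend-fromℕ : ∀ {m} (t : Fin m → Fin m) → extend t (fromℕ m) ≡ fromℕ m
extend-fromℕ {m} t rewrite view-fromℕ m = refl

extend-injective : ∀ {m} (t : Fin m → Fin m) → Injective _≡_ _≡_ t → Injective _≡_ _≡_ (extend t)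
extend-injective t t-inj {a} {b} eq with view a | view b
... | ‵inject₁ i | ‵inject₁ i′ = cong inject₁ (t-inj (F.inject₁-injective eq))
... | ‵inject₁ i | ‵fromℕ      = contradiction (sym eq) F.fromℕ≢inject₁
... | ‵fromℕ     | ‵inject₁ i′ = contradiction eq F.fromℕ≢inject₁
... | ‵fromℕ     | ‵fromℕ      = refl

inject₁<fromℕ : ∀ {m} (i : Fin m) → inject₁ i F.< fromℕ m
inject₁<fromℕ {m} i rewrite F.toℕ-inject₁ i | F.toℕ-fromℕ m = F.toℕ<n i

inject₁-mono-≤ : ∀ {m} {a b : Fin m} → a F.≤ b → inject₁ a F.≤ inject₁ b
inject₁-mono-≤ {a = a} {b} a≤b rewrite F.toℕ-inject₁ a | F.toℕ-inject₁ b = a≤b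

inject₁-mono-< : ∀ {m} {a b : Fin m} → a F.< b → inject₁ a F.< inject₁ b
inject₁-mono-< {a = a} {b} a<b rewrite F.toℕ-inject₁ a | F.toℕ-inject₁ b = a<b

inject₁-cancel-≤ : ∀ {m} {a b : Fin m} → inject₁ a F.≤ inject₁ b → a F.≤ b
inject₁-cancel-≤ {a = a} {b} a≤b rewrite F.toℕ-inject₁ a | F.toℕ-inject₁ b = a≤b

≤inject₁⇒inject₁ : ∀ {m} {y : Fin (suc m)} (x : Fin m) → y F.≤ inject₁ x → ∃ λ x′ → y ≡ inject₁ x′
≤inject₁⇒inject₁ {y = y} x y≤x with view y
... | ‵inject₁ x′ = x′ , refl
... | ‵fromℕ     = contradiction (ℕ.<-≤-trans (inject₁<fromℕ x) y≤x) (ℕ.<-irrefl refl)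

-- Positions and values are 0-based: K : Fin m is the paper's k and fromℕ m is its n.
module Insertion {m : ℕ} (K : Fin m) where

  swapKN : Fin (suc m) → Fin (suc m)
  swapKN = transpose (inject₁ K) (fromℕ m)

  swapKN-K : swapKN (inject₁ K) ≡ fromℕ m
  swapKN-K = transpose-matchˡ (inject₁ K) (fromℕ m)

  swapKN-top : swapKN (fromℕ m) ≡ inject₁ K
  swapKN-top = transpose-matchʳ (inject₁ K) (fromℕ m)

  swapKN-involutive : ∀ j → swapKN (swapKN j) ≡ j
  swapKN-involutive = transpose-involutive (inject₁ K) (fromℕ m)

  swapKN-injective : Injective _≡_ _≡_ swapKN
  swapKN-injective {x} {y} eq =
    trans (sym (swapKN-involutive x)) (trans (cong swapKN eq) (swapKN-involutive y))

  swapKN-inject₁ : ∀ {i} → i ≢ K → swapKN (inject₁ i) ≡ inject₁ i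
  swapKN-inject₁ i≢K = transpose-other _ _ (i≢K ∘ F.inject₁-injective) (F.fromℕ≢inject₁ ∘ sym)

  -- σ(k) = n, σ(n) = τ(k) and σ(i) = τ(i) for every other i.
  record Inserted (τ : Vec (Fin m) m) (σ : Vec (Fin (suc m)) (suc m)) : Set where
    constructor inserted
    field
      lookup-swapKN-extend : ∀ j → lookup σ j ≡ extend (lookup τ) (swapKN j)

    lookup-K : lookup σ (inject₁ K) ≡ fromℕ m
    lookup-K = trans (lookup-swapKN-extend _) (trans (cong (extend _) swapKN-K) (extend-fromℕ _))

    lookup-top : lookup σ (fromℕ m) ≡ inject₁ (lookup τ K)
    lookup-top = trans (lookup-swapKN-extend _) (trans (cong (extend _) swapKN-top) (extend-inject₁ _ K))

    lookup-inject₁ : ∀ {i} → i ≢ K → lookup σ (inject₁ i) ≡ inject₁ (lookup τ i)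
    lookup-inject₁ i≢K = trans (lookup-swapKN-extend _)
      (trans (cong (extend _) (swapKN-inject₁ i≢K)) (extend-inject₁ (lookup τ) _))

    lookup-swapKN : ∀ i → lookup σ (swapKN (inject₁ i)) ≡ inject₁ (lookup τ i)
    lookup-swapKN i = trans (lookup-swapKN-extend _)
      (trans (cong (extend _) (swapKN-involutive (inject₁ i))) (extend-inject₁ (lookup τ) i))

    IsPerm⁺ : IsPerm τ → IsPerm σ
    IsPerm⁺ τ-perm a b eq = swapKN-injective (extend-injective (lookup τ) (τ-perm _ _)
      (trans (sym (lookup-swapKN-extend a)) (trans eq (lookup-swapKN-extend b))))

    IsPerm⁻ : IsPerm σ → IsPerm τ
    IsPerm⁻ σ-perm a b eq = F.inject₁-injective (swapKN-injective
      (σ-perm _ _ (trans (lookup-swapKN a) (trans (cong inject₁ eq) (sym (lookup-swapKN b))))))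

  insert : Vec (Fin m) m → Vec (Fin (suc m)) (suc m)
  insert τ = tabulate (extend (lookup τ) ∘ swapKN)

  insert-Inserted : ∀ τ → Inserted τ (insert τ)
  insert-Inserted τ = inserted (lookup∘tabulate (extend (lookup τ) ∘ swapKN))

  Inserted-unique : ∀ {τ τ′ σ} → Inserted τ σ → Inserted τ′ σ → τ ≡ τ′
  Inserted-unique ins ins′ = Pointwise-≡⇒≡ (ext λ i → F.inject₁-injective
    (trans (sym (Inserted.lookup-swapKN ins i)) (Inserted.lookup-swapKN ins′ i)))

  insert-injective : Injective _≡_ _≡_ insert
  insert-injective {τ} {τ′} eq =
    Inserted-unique (insert-Inserted τ) (subst (Inserted τ′) (sym eq) (insert-Inserted τ′))

  Inserted⇒insert : ∀ {τ σ} → Inserted τ σ → insert τ ≡ σ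
  Inserted⇒insert {τ} ins = Pointwise-≡⇒≡ (ext λ j →
    trans (Inserted.lookup-swapKN-extend (insert-Inserted τ) j) (sym (Inserted.lookup-swapKN-extend ins j)))

  Inserted-exists : ∀ {σ} → IsPerm σ → lookup σ (inject₁ K) ≡ fromℕ m → ∃ λ τ → Inserted τ σ
  Inserted-exists {σ} σ-perm σK≡n = τ , inserted λ j →
    trans (cong (lookup σ) (sym (swapKN-involutive j))) (lookup-σ∘swapKN (view (swapKN j)))
    where
    σ∘swapKN-below : ∀ i → m ≢ toℕ (lookup σ (swapKN (inject₁ i)))
    σ∘swapKN-below i m≡ = F.fromℕ≢inject₁ (swapKN-injective {fromℕ m} {inject₁ i}
      (trans swapKN-top (sym (σ-perm _ _ (trans σ∘swapKN≡n (sym σK≡n))))))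
      where
      σ∘swapKN≡n : lookup σ (swapKN (inject₁ i)) ≡ fromℕ m
      σ∘swapKN≡n = F.toℕ-injective (trans (sym m≡) (sym (F.toℕ-fromℕ m)))
    τ : Vec (Fin m) m
    τ = tabulate λ i → F.lower₁ (lookup σ (swapKN (inject₁ i))) (σ∘swapKN-below i)
    lookup-σ∘swapKN : ∀ {j} → View j → lookup σ (swapKN j) ≡ extend (lookup τ) j
    lookup-σ∘swapKN ‵fromℕ       =
      trans (cong (lookup σ) swapKN-top) (trans σK≡n (sym (extend-fromℕ (lookup τ))))
    lookup-σ∘swapKN (‵inject₁ i) = sym (begin
      extend (lookup τ) (inject₁ i)  ≡⟨ extend-inject₁ (lookup τ) i ⟩
      inject₁ (lookup τ i)           ≡⟨ cong inject₁ (lookup∘tabulate _ i) ⟩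
      inject₁ (F.lower₁ _ _)          ≡⟨ F.inject₁-lower₁ _ (σ∘swapKN-below i) ⟩
      lookup σ (swapKN (inject₁ i))  ∎)
      where open ≡-Reasoning

module InsertionTransfer {m : ℕ} (K : Fin (suc m)) {τ σ} (ins : Insertion.Inserted K τ σ)
                         (τ-perm : IsPerm τ) where

  open Insertion K
  open Inserted ins
  private
    module T = Inom τ τ-perm
    module S = Inom σ (IsPerm⁺ τ-perm)

  -- A τ-step x ↦ τ(x) is a σ-step, except at x = k where σ detours through n, which lies above everything.
  Reaches-inject₁ : ∀ {i y} → T.Reaches i y → S.Reaches (inject₁ i) (inject₁ y)
  Reaches-lookup-inject₁ : ∀ {i} x → T.Reaches i (lookup τ x) → S.Reaches (inject₁ i) (lookup σ (inject₁ x))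

  Reaches-inject₁ T.at            = S.at
  Reaches-inject₁ (T.via i<y r)  = S.via (inject₁-mono-< i<y) (Reaches-lookup-inject₁ _ r)

  Reaches-lookup-inject₁ {i} x r with x F.≟ K
  ... | yes refl = subst (S.Reaches _) (sym lookup-K)
                     (S.via (inject₁<fromℕ i) (subst (S.Reaches _) (sym lookup-top) (Reaches-inject₁ r)))
  ... | no  x≢K  = subst (S.Reaches _) (sym (lookup-inject₁ x≢K)) (Reaches-inject₁ r)

  inom-inject₁ : ∀ i → inom σ (inject₁ i) ≡ inject₁ (inom τ i)
  inom-inject₁ i = S.inom-unique (inject₁-mono-≤ (T.inom-≤ i)) (Reaches-lookup-inject₁ _ (T.inom-Reaches i))

  inom-fromℕ : inom σ (fromℕ (suc m)) ≡ inject₁ K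
  inom-fromℕ = S.inom-unique (ℕ.<⇒≤ (inject₁<fromℕ K)) (subst (S.Reaches _) (sym lookup-K) S.at)

  private
    module W = WeakExceedances τ τ-perm

  InPrefix-inject₁⁺ : ∀ {i x} → InPrefix (inom τ) i x → InPrefix (inom σ) (inject₁ i) (inject₁ x)
  InPrefix-inject₁⁺ (j , j≤i , refl) = inject₁ j , inject₁-mono-≤ j≤i , inom-inject₁ j

  InPrefix-inject₁⁻ : ∀ {i y} → InPrefix (inom σ) (inject₁ i) y →
    ∃ λ x → y ≡ inject₁ x × InPrefix (inom τ) i x
  InPrefix-inject₁⁻ {i} (j , j≤i , refl) with ≤inject₁⇒inject₁ i j≤i
  ... | j′ , refl = inom τ j′ , inom-inject₁ j′ , j′ , inject₁-cancel-≤ j≤i , refl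

  InPrefix-fromℕ⁻ : ∀ {y} → InPrefix (inom σ) (fromℕ (suc m)) y →
    ∃ λ x → y ≡ inject₁ x × (x ≡ K ⊎ IsWeakExceedance τ x)
  InPrefix-fromℕ⁻ (j , _ , refl) with view j
  ... | ‵fromℕ     = K , inom-fromℕ , inj₁ refl
  ... | ‵inject₁ j′ = inom τ j′ , inom-inject₁ j′ , inj₂ (T.inom-weakExceedance j′)

  InPrefix-fromℕ⁺ : ∀ {x} → x ≡ K ⊎ IsWeakExceedance τ x → InPrefix (inom σ) (fromℕ (suc m)) (inject₁ x)
  InPrefix-fromℕ⁺ (inj₁ refl) = fromℕ (suc m) , ℕ.≤-refl , inom-fromℕ
  InPrefix-fromℕ⁺ (inj₂ x≤τx)
    with InPrefix-inject₁⁺ (Equivalence.from (W.inPrefix-fromℕ⇔weakExceedance _) x≤τx)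
  ... | j , _ , eq = j , F.≤fromℕ j , eq

  IsBP2⁻ : IsBP2 σ → IsBP2 τ
  IsBP2⁻ bp i a b c a≤b b≤c pa pc
    with InPrefix-inject₁⁻ (bp (inject₁ i) (inject₁ a) (inject₁ b) (inject₁ c)
           (inject₁-mono-≤ a≤b) (inject₁-mono-≤ b≤c) (InPrefix-inject₁⁺ pa) (InPrefix-inject₁⁺ pc))
  ... | x , eq , px = subst (InPrefix (inom τ) i) (sym (F.inject₁-injective eq)) px

  module _ (bp : IsBP2 τ) (wex≡K : wex τ ≡ toℕ K) where

    weakExceedance⇔<K : ∀ x → IsWeakExceedance τ x ⇔ x F.< K
    weakExceedance⇔<K x = subst (λ w → IsWeakExceedance τ x ⇔ toℕ x < w) wex≡K (W.weakExceedance⇔<wex bp x)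

    InPrefix-fromℕ⇔≤K : ∀ x → InPrefix (inom σ) (fromℕ (suc m)) (inject₁ x) ⇔ x F.≤ K
    InPrefix-fromℕ⇔≤K x = mk⇔ to from
      where
      to : InPrefix (inom σ) (fromℕ (suc m)) (inject₁ x) → x F.≤ K
      to p with InPrefix-fromℕ⁻ p
      ... | x′ , eq , inj₁ refl    rewrite F.inject₁-injective eq = ℕ.≤-refl
      ... | x′ , eq , inj₂ x′≤τx′ rewrite F.inject₁-injective eq =
        ℕ.<⇒≤ (Equivalence.to (weakExceedance⇔<K x′) x′≤τx′)
      from : x F.≤ K → InPrefix (inom σ) (fromℕ (suc m)) (inject₁ x)
      from x≤K with x F.≟ K
      ... | yes x≡K = InPrefix-fromℕ⁺ (inj₁ x≡K)
      ... | no  x≢K = InPrefix-fromℕ⁺ (inj₂ (Equivalence.from (weakExceedance⇔<K x)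
                        (ℕ.≤∧≢⇒< x≤K (x≢K ∘ F.toℕ-injective))))

    IsBP2⁺ : IsBP2 σ
    IsBP2⁺ i′ a b c a≤b b≤c pa pc with view i′
    ... | ‵inject₁ i with InPrefix-inject₁⁻ pa | InPrefix-inject₁⁻ pc
    ...   | a′ , refl , pa′ | c′ , refl , pc′ with ≤inject₁⇒inject₁ c′ b≤c
    ...     | b′ , refl =
      InPrefix-inject₁⁺ (bp i a′ b′ c′ (inject₁-cancel-≤ a≤b) (inject₁-cancel-≤ b≤c) pa′ pc′)
    IsBP2⁺ i′ a b c a≤b b≤c pa pc | ‵fromℕ with InPrefix-fromℕ⁻ pc
    ... | c′ , refl , _ with ≤inject₁⇒inject₁ c′ b≤c
    ...   | b′ , refl = Equivalence.from (InPrefix-fromℕ⇔≤K b′)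
              (ℕ.≤-trans (inject₁-cancel-≤ b≤c) (Equivalence.to (InPrefix-fromℕ⇔≤K c′) pc))

  wex-inserted : ¬ IsWeakExceedance τ K → wex σ ≡ suc (wex τ)
  wex-inserted ¬K≤τK = begin
    wex σ                     ≡⟨ length-filter-tabulate σ-wex? id ⟩
    count σ-wex?              ≡⟨ count-¬fromℕ σ-wex? ¬n≤σn ⟩
    count (σ-wex? ∘ inject₁)  ≡⟨ count-one-extra (σ-wex? ∘ inject₁) τ-wex? K
                                   agree-inject₁ agree-inject₁⁻ K≤σK ¬K≤τK ⟩
    suc (count τ-wex?)        ≡⟨ cong suc (length-filter-tabulate τ-wex? id) ⟨
    suc (wex τ)               ∎
    where
    open ≡-Reasoning
    σ-wex? : Decidable (IsWeakExceedance σ)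
    σ-wex? x = x F.≤? lookup σ x
    τ-wex? : Decidable (IsWeakExceedance τ)
    τ-wex? x = x F.≤? lookup τ x
    ¬n≤σn : ¬ IsWeakExceedance σ (fromℕ (suc m))
    ¬n≤σn n≤σn = ℕ.<-irrefl refl
      (ℕ.<-≤-trans (subst (F._< fromℕ (suc m)) (sym lookup-top) (inject₁<fromℕ (lookup τ K))) n≤σn)
    K≤σK : IsWeakExceedance σ (inject₁ K)
    K≤σK = subst (inject₁ K F.≤_) (sym lookup-K) (ℕ.<⇒≤ (inject₁<fromℕ K))
    agree-inject₁ : ∀ x → x ≢ K → IsWeakExceedance σ (inject₁ x) → IsWeakExceedance τ x
    agree-inject₁ x x≢K x≤σx = inject₁-cancel-≤ (subst (inject₁ x F.≤_) (lookup-inject₁ x≢K) x≤σx)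
    agree-inject₁⁻ : ∀ x → x ≢ K → IsWeakExceedance τ x → IsWeakExceedance σ (inject₁ x)
    agree-inject₁⁻ x x≢K x≤τx = subst (inject₁ x F.≤_) (sym (lookup-inject₁ x≢K)) (inject₁-mono-≤ x≤τx)

-- The bijection

module InsertionBijection {m : ℕ} (K : Fin (suc m)) where

  open Insertion K

  private
    k : ℕ
    k = suc (toℕ K)

  KNPerms : List (Vec (Fin (suc (suc m))) (suc (suc m)))
  KNPerms = filter (λ σ → lastBelow? σ k) (filter (λ σ → mapsKtoN? σ k) (BP2 (suc (suc m)) k))

  KNPerms-unique : Unique KNPerms
  KNPerms-unique =
    Unique.filter⁺ (λ σ → lastBelow? σ k) (Unique.filter⁺ (λ σ → mapsKtoN? σ k) (BP2-unique _ k))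

  MapsKtoN⇔ : ∀ σ → MapsKtoN σ k ⇔ lookup σ (inject₁ K) ≡ fromℕ (suc m)
  MapsKtoN⇔ σ = mk⇔
    (λ { (p , p≡K , σp≡n) → subst (λ q → lookup σ q ≡ fromℕ (suc m))
           (F.toℕ-injective (trans p≡K (sym (F.toℕ-inject₁ K))))
           (F.toℕ-injective (trans σp≡n (sym (F.toℕ-fromℕ (suc m))))) })
    (λ σK≡n → inject₁ K , F.toℕ-inject₁ K , trans (cong toℕ σK≡n) (F.toℕ-fromℕ (suc m)))

  LastBelow⇔ : ∀ {τ σ} → Inserted τ σ → LastBelow σ k ⇔ lookup τ K F.< K
  LastBelow⇔ {τ} {σ} ins = mk⇔
    (λ below → subst (ℕ._< toℕ K) σn≡τK (ℕ.s<s⁻¹ (below (fromℕ (suc m)) (F.toℕ-fromℕ (suc m)))))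
    (λ τK<K p p≡n → s≤s (subst (ℕ._< toℕ K) (sym (trans (cong (toℕ ∘ lookup σ) (p≡fromℕ p≡n)) σn≡τK)) τK<K))
    where
    open Inserted ins
    σn≡τK : toℕ (lookup σ (fromℕ (suc m))) ≡ toℕ (lookup τ K)
    σn≡τK = trans (cong toℕ lookup-top) (F.toℕ-inject₁ _)
    p≡fromℕ : ∀ {p} → toℕ p ≡ suc m → p ≡ fromℕ (suc m)
    p≡fromℕ p≡n = F.toℕ-injective (trans p≡n (sym (F.toℕ-fromℕ (suc m))))

  ∈-KNPerms⁻ : ∀ {σ} → σ ∈ KNPerms → (IsPerm σ × IsBP2 σ × wex σ ≡ k) × MapsKtoN σ k × LastBelow σ k
  ∈-KNPerms⁻ {σ} σ∈ = ∈-BP2⁻ (proj₁ σ∈″) , proj₂ σ∈″ , proj₂ σ∈′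
    where
    σ∈′ : σ ∈ filter (λ σ → mapsKtoN? σ k) (BP2 _ k) × LastBelow σ k
    σ∈′ = ∈-filter⁻ (λ σ → lastBelow? σ k) {xs = filter (λ σ → mapsKtoN? σ k) (BP2 _ k)} σ∈
    σ∈″ : σ ∈ BP2 _ k × MapsKtoN σ k
    σ∈″ = ∈-filter⁻ (λ σ → mapsKtoN? σ k) {xs = BP2 _ k} (proj₁ σ∈′)

  ∈-KNPerms⁺ : ∀ {σ} → IsPerm σ → IsBP2 σ → wex σ ≡ k → MapsKtoN σ k → LastBelow σ k → σ ∈ KNPerms
  ∈-KNPerms⁺ σ-perm bp wex≡k maps below =
    ∈-filter⁺ (λ σ → lastBelow? σ k) {xs = filter (λ σ → mapsKtoN? σ k) (BP2 _ k)}
      (∈-filter⁺ (λ σ → mapsKtoN? σ k) {xs = BP2 _ k} (∈-BP2⁺ σ-perm bp wex≡k) maps) below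

  -- Matching on the hypotheses instead of using 'with' keeps Agda from normalising the enumeration BP2.
  insert-∈ : ∀ {τ} → τ ∈ BP2 (suc m) (toℕ K) → insert τ ∈ KNPerms
  insert-∈ {τ} τ∈ = insert-∈′ {τ} (∈-BP2⁻ τ∈)
    where
    insert-∈′ : ∀ {τ} → IsPerm τ × IsBP2 τ × wex τ ≡ toℕ K → insert τ ∈ KNPerms
    insert-∈′ {τ} (τ-perm , bp , wex≡K) =
      ∈-KNPerms⁺ (IsPerm⁺ τ-perm) (IsBP2⁺ bp wex≡K) (trans (wex-inserted ¬K≤τK) (cong suc wex≡K))
        (Equivalence.from (MapsKtoN⇔ (insert τ)) lookup-K) (Equivalence.from (LastBelow⇔ ins) (ℕ.≰⇒> ¬K≤τK))
      where
      ins : Inserted τ (insert τ)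
      ins = insert-Inserted τ
      open Inserted ins
      open InsertionTransfer K {τ} {insert τ} ins τ-perm
      ¬K≤τK : ¬ IsWeakExceedance τ K
      ¬K≤τK K≤τK = ℕ.<-irrefl refl (Equivalence.to (weakExceedance⇔<K bp wex≡K K) K≤τK)

  ∈-insert : ∀ {σ} → σ ∈ KNPerms → ∃ λ τ → τ ∈ BP2 (suc m) (toℕ K) × insert τ ≡ σ
  ∈-insert {σ} σ∈ = ∈-insert′ {σ} (∈-KNPerms⁻ σ∈)
    where
    ∈-insert′ : ∀ {σ} → (IsPerm σ × IsBP2 σ × wex σ ≡ k) × MapsKtoN σ k × LastBelow σ k →
      ∃ λ τ → τ ∈ BP2 (suc m) (toℕ K) × insert τ ≡ σ
    ∈-insert′ {σ} ((σ-perm , bp , wex≡k) , maps , below) =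
      τ , ∈-BP2⁺ τ-perm (IsBP2⁻ bp) (ℕ.suc-injective (trans (sym (wex-inserted ¬K≤τK)) wex≡k)) ,
      Inserted⇒insert ins
      where
      preimage : ∃ λ τ → Inserted τ σ
      preimage = Inserted-exists σ-perm (Equivalence.to (MapsKtoN⇔ σ) maps)
      τ : Vec (Fin (suc m)) (suc m)
      τ = proj₁ preimage
      ins : Inserted τ σ
      ins = proj₂ preimage
      τ-perm : IsPerm τ
      τ-perm = Inserted.IsPerm⁻ ins σ-perm
      open InsertionTransfer K {τ} {σ} ins τ-perm
      ¬K≤τK : ¬ IsWeakExceedance τ K
      ¬K≤τK = ℕ.<⇒≱ (Equivalence.to (LastBelow⇔ ins) below)

  b≡countKN : b (suc m) (toℕ K) ≡ countKN (suc (suc m)) k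
  b≡countKN =
    length-≡-by-bijection (BP2-unique _ _) KNPerms-unique insert insert-injective insert-∈ ∈-insert

mainTheorem7 : (n k : ℕ) → 3 ≤ n → 1 < k → k < n →
    b (n ∸ 1) (k ∸ 1) ≡ countKN n k
mainTheorem7 (suc (suc m)) (suc k′) _ _ (s≤s k′<1+m) =
  subst (λ k → b (suc m) k ≡ countKN (suc (suc m)) (suc k)) (F.toℕ-fromℕ< k′<1+m)
    (InsertionBijection.b≡countKN (fromℕ< k′<1+m))
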